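{- Let $\mathcal T$ be a tower diagram and let $c_1=(i,j_1)$ and $c_2=(i,j_2)$ be two cells of $\mathcal T$ lying in the same tower $\mathcal T_i$. Assume that $c_1$ and $c_2$ both have flight paths in $\mathcal T$, with flight numbers $f_1$ and $f_2$ respectively. Then $|f_1-f_2|\ge |j_1-j_2|$. Moreover, if $|j_1-j_2|=1$ then $|f_1-f_2|=1$.
   Context: A cell is a pair $(i,j)$ of integers with $i\ge 1$, $j\ge 0$ (drawn as the unit square whose south-east corner is the point $(i,j)$). A tower diagram is a finite set $\mathcal T$ of cells such that $(i,j)\in\mathcal T$ and $0\le k\le j$ imply $(i,k)\in\mathcal T$. Its $i$-th tower is $\mathcal T_i=\{(i,j)\in\mathcal T\}$. The cell $(i,j)$ lies on the diagonal $x+y=i+j$. Flight paths are defined recursively: a cell $(i,j)\in\mathcal T$ has a flight path in $\mathcal T$ if either (F1) there is no cell $(i',j')\in\mathcal T$ with $i'<i$ and $i'+j'=i+j-1$, in which case its flight path is $\{(i,j)\}$; or (F2) such cells exist and, letting $(i',j')$ be the one with the largest $i'$, the cell $(i',j')$ has a flight path in $\mathcal T$ and $(i',j'+1)\in\mathcal T$, in which case the flight path of $(i,j)$ is $\{(i,j),(i',j'+1)\}\cup\mathrm{flightpath}((i',j'),\mathcal T)$. If $(i,j)$ has a flight path, its flight number is $a+b$, where $(a,b)$ is the lexicographically smallest element of its flight path. -}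

module Defs where

open import Data.Nat using (ℕ; zero; suc; _+_; _∸_; _≤_; _<_; _<ᵇ_; _≡ᵇ_; _≤ᵇ_)
open import Data.Bool using (Bool; true; false; if_then_else_; _∨_; _∧_)
open import Data.Product using (_×_; _,_; proj₁; proj₂)
open import Data.List using (List; []; _∷_)
open import Data.List.Membership.Propositional using (_∈_)
open import Data.List.Relation.Unary.All using (All)
open import Relation.Nullary using (¬_)
open import Relation.Binary.PropositionalEquality using (_≡_)

-- A cell (i , j): i is the tower index (≥ 1), j the height (≥ 0).
Cell : Set
Cell = ℕ × ℕ

record TowerDiagram : Set where
  field
    cells     : List Cell
    col-pos   : All (λ c → 1 ≤ proj₁ c) cells
    down-closed : ∀ i j k → (i , j) ∈ cells → k ≤ j → (i , k) ∈ cells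
open TowerDiagram public

-- FlightPath T c p : the cell c has a flight path in T, namely (the set of
-- elements of) the list p.  Inductive rendering of the recursive definition.
data FlightPath (T : TowerDiagram) : Cell → List Cell → Set where
  F1 : ∀ {i j} → (i , j) ∈ cells T →
       (∀ {i' j'} → (i' , j') ∈ cells T → i' < i → ¬ (i' + j' ≡ (i + j) ∸ 1)) →
       FlightPath T (i , j) ((i , j) ∷ [])
  F2 : ∀ {i j i' j' p} → (i , j) ∈ cells T →
       (i' , j') ∈ cells T → i' < i → i' + j' ≡ (i + j) ∸ 1 →
       (∀ {i'' j''} → (i'' , j'') ∈ cells T → i'' < i → i'' + j'' ≡ (i + j) ∸ 1 → i'' ≤ i') →
       FlightPath T (i' , j') p →
       (i' , suc j') ∈ cells T →
       FlightPath T (i , j) ((i , j) ∷ (i' , suc j') ∷ p)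

_≤lexᵇ_ : Cell → Cell → Bool
(a , b) ≤lexᵇ (a' , b') = (a <ᵇ a') ∨ ((a ≡ᵇ a') ∧ (b ≤ᵇ b'))

lexMin : Cell → List Cell → Cell
lexMin c [] = c
lexMin c (d ∷ ds) = if c ≤lexᵇ d then lexMin c ds else lexMin d ds

flightNumber : List Cell → ℕ
flightNumber [] = 0
flightNumber (c ∷ cs) = let m = lexMin c cs in proj₁ m + proj₂ m

-- Each step of a flight path descends by one diagonal and ends in an earlier
-- tower, so the lexicographically smallest cell of the path is its last one
-- and the flight number of a cell is its diagonal minus the number of steps.
-- By down-closure, a tower that meets a high diagonal meets every lower one,
-- so a cell in an earlier tower and on a higher diagonal has a flight path of
-- at most as many steps.  In one tower this bounds the difference of flight
-- numbers from below by the difference of heights.  For adjacent cells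
-- (i, j) and (i, j + 1) the step counts agree: the cell above the predecessor
-- of (i, j) is the predecessor of (i, j + 1).
module Submission where

open import Defs
open import Data.Nat using (ℕ; zero; suc; _<ᵇ_; _≡ᵇ_; _+_; _∸_; _≤_; _<_; pred; ∣_-_∣; s≤s; z≤n)
open import Data.Nat.Properties
open import Data.Bool using (true; false)
open import Data.Bool.Properties using (T-≡)
open import Function.Bundles using (Equivalence)
open import Data.Product using (∃; _,_; _×_; proj₁; proj₂)
open import Data.Sum as Sum using (_⊎_; inj₁; inj₂)
open import Data.List using (List; []; _∷_)
open import Data.List.Membership.Propositional using (_∈_)
open import Data.Empty using (⊥-elim)
open import Data.Nat.Tactic.RingSolver using (solve-∀)
open import Relation.Binary.PropositionalEquality

pathLength : ∀ {T c p} → FlightPath T c p → ℕ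
pathLength (F1 _ _)           = 0
pathLength (F2 _ _ _ _ _ P _) = suc (pathLength P)

flightPath-head : ∀ {T c p} → FlightPath T c p → ∃ λ qs → p ≡ c ∷ qs
flightPath-head (F1 _ _)           = [] , refl
flightPath-head (F2 _ _ _ _ _ _ _) = _ , refl

suc-pred-+ : ∀ {m a} x → m < a → suc (pred (a + x)) ≡ a + x
suc-pred-+ _ (s≤s _) = refl

≤⇒≮ᵇ : ∀ {m n} → n ≤ m → (m <ᵇ n) ≡ false
≤⇒≮ᵇ z≤n       = refl
≤⇒≮ᵇ (s≤s n≤m) = ≤⇒≮ᵇ n≤m

>⇒≢ᵇ : ∀ {m n} → n < m → (m ≡ᵇ n) ≡ false
>⇒≢ᵇ {n = zero}  (s≤s _)   = refl
>⇒≢ᵇ {n = suc _} (s≤s n<m) = >⇒≢ᵇ n<m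

≡ᵇ-refl : ∀ m → (m ≡ᵇ m) ≡ true
≡ᵇ-refl m = Equivalence.to T-≡ (≡⇒≡ᵇ m m refl)

lexMin-skipStep : ∀ {a b i j} qs → i < a →
                  lexMin (a , b) ((i , suc j) ∷ (i , j) ∷ qs) ≡ lexMin (i , j) qs
lexMin-skipStep {i = i} {j} _ i<a
  rewrite ≤⇒≮ᵇ (<⇒≤ i<a) | >⇒≢ᵇ i<a | ≤⇒≮ᵇ (≤-refl {i}) | ≡ᵇ-refl i | ≤⇒≮ᵇ (≤-refl {j})
  = refl

flightNumber+pathLength : ∀ {T a b p} (P : FlightPath T (a , b) p) →
                          flightNumber p + pathLength P ≡ a + b
flightNumber+pathLength (F1 _ _) = +-identityʳ _
flightNumber+pathLength {a = a} {b} (F2 {i' = i'} {j'} _ _ i'<a diagonal _ P _)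
  with flightPath-head P | flightNumber+pathLength P
... | qs , refl | ih = begin
  flightNumber ((a , b) ∷ (i' , suc j') ∷ (i' , j') ∷ qs) + suc (pathLength P)
    ≡⟨ cong (λ c → proj₁ c + proj₂ c + suc (pathLength P)) (lexMin-skipStep qs i'<a) ⟩
  flightNumber ((i' , j') ∷ qs) + suc (pathLength P)  ≡⟨ +-suc _ _ ⟩
  suc (flightNumber ((i' , j') ∷ qs) + pathLength P)  ≡⟨ cong suc (trans ih diagonal) ⟩
  suc (pred (a + b))                                  ≡⟨ suc-pred-+ b i'<a ⟩
  a + b                                               ∎
  where open ≡-Reasoning

aboveOnDiagonal : ∀ {i j} a x → i < a → i + j ≡ pred (a + x) → i + suc j ≡ pred (a + suc x)
aboveOnDiagonal {i} {j} a x i<a diagonal = begin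
  i + suc j           ≡⟨ +-suc i j ⟩
  suc (i + j)         ≡⟨ cong suc diagonal ⟩
  suc (pred (a + x))  ≡⟨ suc-pred-+ x i<a ⟩
  a + x               ≡⟨ cong pred (+-suc a x) ⟨
  pred (a + suc x)    ∎
  where open ≡-Reasoning

cellOnPredDiagonal : ∀ T {i j a x} → (i , j) ∈ cells T → i < a → pred (a + x) ≤ i + j →
                     ∃ λ k → (i , k) ∈ cells T × i + k ≡ pred (a + x)
cellOnPredDiagonal T {i} {j} {a} {x} cell i<a d≤i+j =
  d ∸ i , down-closed T i j (d ∸ i) cell d∸i≤j , m+[n∸m]≡n i≤d
  where
  d = pred (a + x)
  i≤d : i ≤ d
  i≤d = <⇒≤pred (≤-trans i<a (m≤m+n a x))
  d∸i≤j : d ∸ i ≤ j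
  d∸i≤j = subst (d ∸ i ≤_) (m+n∸m≡n i j) (∸-monoˡ-≤ i d≤i+j)

pathLength-mono : ∀ {T a x a' y p q} (P : FlightPath T (a , x) p) (Q : FlightPath T (a' , y) q) →
                  a' ≤ a → a + x ≤ a' + y → pathLength Q ≤ pathLength P
pathLength-mono _ (F1 _ _) _ _ = z≤n
pathLength-mono {T} {a} {x} P (F2 _ cell i'<a' diagonal' _ Q _) a'≤a below
  with cellOnPredDiagonal T cell (<-≤-trans i'<a' a'≤a)
                          (subst (pred (a + x) ≤_) (sym diagonal') (pred-mono-≤ below))
pathLength-mono (F1 _ noPredecessor) (F2 _ _ i'<a' _ _ _ _) a'≤a _ | _ , cell , diagonal =
  ⊥-elim (noPredecessor cell (<-≤-trans i'<a' a'≤a) diagonal)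
pathLength-mono (F2 _ _ _ diagonal maximal P _) (F2 _ _ i'<a' diagonal' _ Q _) a'≤a below
  | _ , cell , diagonal'' =
  s≤s (pathLength-mono P Q (maximal cell (<-≤-trans i'<a' a'≤a) diagonal'')
                           (subst₂ _≤_ (sym diagonal) (sym diagonal') (pred-mono-≤ below)))

pathLength-≤-above : ∀ {T a x b y p q} (P : FlightPath T (a , x) p) (Q : FlightPath T (b , y) q) →
                     b ≡ a → y ≡ suc x → pathLength P ≤ pathLength Q
pathLength-≤-above (F1 _ _) _ _ _ = z≤n
pathLength-≤-above {a = a} {x} (F2 _ _ i'<a diagonal _ _ above) (F1 _ noPredecessor) refl refl =
  ⊥-elim (noPredecessor above i'<a (aboveOnDiagonal a x i'<a diagonal))
pathLength-≤-above {T} {a} {x} (F2 {i' = i'} {j'} _ _ i'<a diagonal maximal P above)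
                               (F2 {i' = i''} {j''} _ cell i''<a diagonal'' maximal'' Q _) refl refl =
  s≤s (pathLength-≤-above P Q i''≡i' j''≡1+j')
  where
  i''+j''≡a+x : i'' + j'' ≡ a + x
  i''+j''≡a+x = trans diagonal'' (cong pred (+-suc a x))
  i''≡i' : i'' ≡ i'
  i''≡i' with cellOnPredDiagonal T cell i''<a (subst (pred (a + x) ≤_) (sym i''+j''≡a+x) pred[n]≤n)
  ... | _ , cell' , diagonal' = ≤-antisym (maximal cell' i''<a diagonal')
                                          (maximal'' above i'<a (aboveOnDiagonal a x i'<a diagonal))
  j''≡1+j' : j'' ≡ suc j'
  j''≡1+j' = +-cancelˡ-≡ i'' _ _
    (trans diagonal'' (trans (sym (aboveOnDiagonal a x i'<a diagonal)) (cong (_+ suc j') (sym i''≡i'))))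

+-∸-exchange : ∀ {f₁ f₂ s₁ s₂ i j₁ j₂} → f₁ + s₁ ≡ i + j₁ → f₂ + s₂ ≡ i + j₂ →
               j₁ ≤ j₂ → s₂ ≤ s₁ → f₂ ≡ f₁ + ((j₂ ∸ j₁) + (s₁ ∸ s₂))
+-∸-exchange {f₁} {f₂} {s₁} {s₂} {i} {j₁} {j₂} e₁ e₂ j₁≤j₂ s₂≤s₁ = +-cancelʳ-≡ s₂ _ _ (begin
  f₂ + s₂                   ≡⟨ e₂ ⟩
  i + j₂                    ≡⟨ cong (i +_) (m+[n∸m]≡n j₁≤j₂) ⟨
  i + (j₁ + d)              ≡⟨ +-assoc i j₁ d ⟨
  i + j₁ + d                ≡⟨ cong (_+ d) e₁ ⟨
  f₁ + s₁ + d               ≡⟨ cong (λ s → f₁ + s + d) (m+[n∸m]≡n s₂≤s₁) ⟨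
  f₁ + (s₂ + e) + d         ≡⟨ rearrange f₁ s₂ e d ⟩
  f₁ + (d + e) + s₂         ∎)
  where
  open ≡-Reasoning
  d = j₂ ∸ j₁
  e = s₁ ∸ s₂
  rearrange : ∀ f s e d → f + (s + e) + d ≡ f + (d + e) + s
  rearrange = solve-∀

flightNumber-sameTower : ∀ {T i j₁ j₂ p₁ p₂} (P : FlightPath T (i , j₁) p₁) (Q : FlightPath T (i , j₂) p₂) →
                         j₁ ≤ j₂ →
                         flightNumber p₂ ≡ flightNumber p₁ + ((j₂ ∸ j₁) + (pathLength P ∸ pathLength Q))
flightNumber-sameTower {i = i} P Q j₁≤j₂ =
  +-∸-exchange (flightNumber+pathLength P) (flightNumber+pathLength Q) j₁≤j₂
               (pathLength-mono P Q ≤-refl (+-monoʳ-≤ i j₁≤j₂))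

flightNumber-distance-≥ : ∀ {T i j₁ j₂ p₁ p₂} → FlightPath T (i , j₁) p₁ → FlightPath T (i , j₂) p₂ →
                          j₁ ≤ j₂ → ∣ j₁ - j₂ ∣ ≤ ∣ flightNumber p₁ - flightNumber p₂ ∣
flightNumber-distance-≥ {j₁ = j₁} {j₂} {p₁} {p₂} P Q j₁≤j₂ = begin
  ∣ j₁ - j₂ ∣                    ≡⟨ m≤n⇒∣m-n∣≡n∸m j₁≤j₂ ⟩
  j₂ ∸ j₁                        ≤⟨ m≤m+n (j₂ ∸ j₁) e ⟩
  (j₂ ∸ j₁) + e                  ≡⟨ ∣m-m+n∣≡n f₁ _ ⟨
  ∣ f₁ - f₁ + ((j₂ ∸ j₁) + e) ∣  ≡⟨ cong (∣ f₁ -_∣) (flightNumber-sameTower P Q j₁≤j₂) ⟨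
  ∣ f₁ - flightNumber p₂ ∣       ∎
  where
  open ≤-Reasoning
  f₁ = flightNumber p₁
  e = pathLength P ∸ pathLength Q

flightNumber-distance-above : ∀ {T i j p₁ p₂} → FlightPath T (i , j) p₁ → FlightPath T (i , suc j) p₂ →
                              ∣ flightNumber p₁ - flightNumber p₂ ∣ ≡ 1
flightNumber-distance-above {j = j} {p₁} {p₂} P Q = begin
  ∣ f₁ - flightNumber p₂ ∣               ≡⟨ cong (∣ f₁ -_∣) (flightNumber-sameTower P Q (n≤1+n j)) ⟩
  ∣ f₁ - f₁ + ((suc j ∸ j) + e) ∣        ≡⟨ ∣m-m+n∣≡n f₁ _ ⟩
  (suc j ∸ j) + e                        ≡⟨ cong₂ _+_ (m+n∸n≡m 1 j) (m≤n⇒m∸n≡0 (pathLength-≤-above P Q refl refl)) ⟩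
  1                                      ∎
  where
  open ≡-Reasoning
  f₁ = flightNumber p₁
  e = pathLength P ∸ pathLength Q

∣m-n∣≡1⇒n≡1+m⊎m≡1+n : ∀ m n → ∣ m - n ∣ ≡ 1 → n ≡ suc m ⊎ m ≡ suc n
∣m-n∣≡1⇒n≡1+m⊎m≡1+n zero    (suc n) eq = inj₁ (cong suc (suc-injective eq))
∣m-n∣≡1⇒n≡1+m⊎m≡1+n (suc m) zero    eq = inj₂ (cong suc (suc-injective eq))
∣m-n∣≡1⇒n≡1+m⊎m≡1+n (suc m) (suc n) eq = Sum.map (cong suc) (cong suc) (∣m-n∣≡1⇒n≡1+m⊎m≡1+n m n eq)

flightNumber-distance-bound : ∀ {T i j₁ j₂ p₁ p₂} → FlightPath T (i , j₁) p₁ → FlightPath T (i , j₂) p₂ →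
                              ∣ j₁ - j₂ ∣ ≤ ∣ flightNumber p₁ - flightNumber p₂ ∣
flightNumber-distance-bound {j₁ = j₁} {j₂} {p₁} {p₂} P Q with ≤-total j₁ j₂
... | inj₁ j₁≤j₂ = flightNumber-distance-≥ P Q j₁≤j₂
... | inj₂ j₂≤j₁ = subst₂ _≤_ (∣-∣-comm j₂ j₁) (∣-∣-comm (flightNumber p₂) (flightNumber p₁))
                           (flightNumber-distance-≥ Q P j₂≤j₁)

flightNumber-distance-one : ∀ {T i j₁ j₂ p₁ p₂} → FlightPath T (i , j₁) p₁ → FlightPath T (i , j₂) p₂ →
                            ∣ j₁ - j₂ ∣ ≡ 1 → ∣ flightNumber p₁ - flightNumber p₂ ∣ ≡ 1
flightNumber-distance-one {j₁ = j₁} {j₂} {p₁} {p₂} P Q d≡1 with ∣m-n∣≡1⇒n≡1+m⊎m≡1+n j₁ j₂ d≡1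
... | inj₁ refl = flightNumber-distance-above P Q
... | inj₂ refl = trans (∣-∣-comm (flightNumber p₁) (flightNumber p₂)) (flightNumber-distance-above Q P)

lemma2p5 : (T : TowerDiagram) (i j₁ j₂ : ℕ) (p₁ p₂ : List Cell) →
           (i , j₁) ∈ cells T → (i , j₂) ∈ cells T →
           FlightPath T (i , j₁) p₁ → FlightPath T (i , j₂) p₂ →
           (∣ j₁ - j₂ ∣ ≤ ∣ flightNumber p₁ - flightNumber p₂ ∣)
           × (∣ j₁ - j₂ ∣ ≡ 1 → ∣ flightNumber p₁ - flightNumber p₂ ∣ ≡ 1)
lemma2p5 _ _ _ _ _ _ _ _ P Q = flightNumber-distance-bound P Q , flightNumber-distance-one P Q
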